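{- Let $r\ge1$ be an integer. There exists a routing algorithm for $r$-central routing on the full-duplex infinite triangular grid (store-and-forward $\Delta$-port model) that delivers all packets in $\binom{r+1}{2}$ steps, and no schedule can deliver all packets in fewer than $\binom{r+1}{2}$ steps.
   Context: Triangular grid: the infinite graph with vertex set $\mathbb{Z}^2$ in which $(x,y)$ is adjacent to $(x\pm1,y)$, $(x,y\pm1)$, $(x+1,y+1)$ and $(x-1,y-1)$ (each vertex has 6 neighbours). $r$-central routing: a central node $v$ is fixed and every node at distance between $1$ and $r$ from $v$ holds exactly one packet whose destination is $v$. Routing model: time proceeds in synchronous steps; in each step each packet either stays at its current node (unbounded queues) or moves along one incident edge; a node may use all its incident edges simultaneously; full-duplex: each edge can be traversed by at most one packet per step in each direction. The running time is the number of steps until all packets have reached their destination. -}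

module Defs where

open import Data.Integer using (ℤ; _+_; _-_; 1ℤ)
open import Data.Nat using (ℕ; zero; suc; _≤_)
open import Data.Product using (Σ; _×_; _,_; proj₁)
open import Data.Sum using (_⊎_)
open import Relation.Binary.PropositionalEquality using (_≡_; _≢_)

Node : Set
Node = ℤ × ℤ

data Adj : Node → Node → Set where
  right : ∀ x y → Adj (x , y) (x + 1ℤ , y)
  left  : ∀ x y → Adj (x , y) (x - 1ℤ , y)
  up    : ∀ x y → Adj (x , y) (x , y + 1ℤ)
  down  : ∀ x y → Adj (x , y) (x , y - 1ℤ)
  diag+ : ∀ x y → Adj (x , y) (x + 1ℤ , y + 1ℤ)
  diag- : ∀ x y → Adj (x , y) (x - 1ℤ , y - 1ℤ)

data Walk : Node → Node → ℕ → Set where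
  here : ∀ {u} → Walk u u 0
  step : ∀ {u w z n} → Adj u w → Walk w z n → Walk u z (suc n)

DistLE : Node → Node → ℕ → Set
DistLE u v r = Σ ℕ λ n → n ≤ r × Walk u v n

-- u holds a packet in r-central routing to v: 1 ≤ d(u,v) ≤ r
IsSource : Node → ℕ → Node → Set
IsSource v r u = u ≢ v × DistLE u v r

-- packets are identified with their source nodes
Packet : Node → ℕ → Set
Packet v r = Σ Node (IsSource v r)

Move : Node → Node → Set
Move a b = a ≡ b ⊎ Adj a b

-- A (store-and-forward, full-duplex, Δ-port) schedule for r-central routing to v:
-- pos p t is the node holding packet p after t steps.
record Schedule (v : Node) (r : ℕ) : Set where
  field
    pos      : Packet v r → ℕ → Node
    start    : ∀ p → pos p 0 ≡ proj₁ p
    moves    : ∀ p t → Move (pos p t) (pos p (suc t))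
    absorbed : ∀ p t → pos p t ≡ v → pos p (suc t) ≡ v
    -- full duplex: at most one packet crosses a given edge in a given
    -- direction per step
    capacity : ∀ p q t → proj₁ p ≢ proj₁ q →
               pos p t ≡ pos q t → pos p (suc t) ≡ pos q (suc t) →
               pos p t ≡ pos p (suc t)

DeliversBy : ∀ {v r} → Schedule v r → ℕ → Set
DeliversBy {v} S T = ∀ p → Schedule.pos S p T ≡ v

module Submission where

-- Nodes are points of ℤ², an edge adds one of six unit vectors, and
-- translations and the 60° rotation (x , y) ↦ (x - y , x) are automorphisms.
-- The base sector is the lattice of offsets A·(1,0) + B·(1,1); its five rotated
-- copies cover ℤ² ∖ {0} exactly once by the "rays" (A ≥ 1).  A ray point with
-- coordinates (a+1 , b) lies at distance at least a+1+b from the centre, because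
-- the three heights x, y and x - y change by at most one along an edge.  Listing the cells of a sector diagonal by diagonal, with the
-- direction alternating (a parity-oriented Cantor unpairing), gives a path whose
-- first T r cells are exactly the sector's nodes at distance ≤ r.  Along each of the six conveyors every packet moves one cell
-- towards the centre per step; packets never meet outside v and all arrive by T r.  Each of the 6·T r packets enters v through one of its six edges;
-- full duplex makes (arrival step, edge) injective, so 6·T r ≤ 6·T.

open import Defs
open import Data.Nat using (ℕ; zero; suc; _≤_; z≤n; s≤s)
import Data.Nat as ℕ
import Data.Nat.Properties as ℕₚ
open import Data.Nat.Combinatorics using (_C_)
open import Data.Fin using (Fin; toℕ)
open import Data.Fin.Patterns using (0F; 1F; 2F; 3F; 4F; 5F)
open import Data.Maybe using (Maybe; just; nothing)
open import Data.Product using (Σ; _×_; _,_; proj₁; proj₂)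
open import Data.Sum using (_⊎_; inj₁; inj₂)
open import Data.Empty using (⊥-elim)
open import Relation.Binary.PropositionalEquality

module Grid where
  open import Data.Integer using (ℤ; +_; -[1+_]; 1ℤ; _+_; _-_)
  import Data.Integer.Properties as ℤₚ
  open import Data.Integer.Tactic.RingSolver using (solve-∀)

  origin : Node
  origin = (+ 0 , + 0)

  infixl 6 _⊕_ _⊖_

  _⊕_ : Node → Node → Node
  (a , b) ⊕ (c , d) = (a + c , b + d)

  _⊖_ : Node → Node → Node
  (a , b) ⊖ (c , d) = (a - c , b - d)

  ⊕-origin : ∀ u → u ⊕ origin ≡ u
  ⊕-origin (a , b) = cong₂ _,_ (ℤₚ.+-identityʳ a) (ℤₚ.+-identityʳ b)

  ⊕-assoc : ∀ u v w → (u ⊕ v) ⊕ w ≡ u ⊕ (v ⊕ w)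
  ⊕-assoc (a , b) (c , d) (e , f) = cong₂ _,_ (ℤₚ.+-assoc a c e) (ℤₚ.+-assoc b d f)

  ⊕-⊖ : ∀ v u → v ⊕ (u ⊖ v) ≡ u
  ⊕-⊖ (c , d) (a , b) = cong₂ _,_ (identity c a) (identity d b)
    where identity : ∀ c a → c + (a - c) ≡ a
          identity = solve-∀

  ⊕-cancelˡ : ∀ v {o o'} → v ⊕ o ≡ v ⊕ o' → o ≡ o'
  ⊕-cancelˡ v {o} {o'} eq = trans (sym (⊖-⊕ v o)) (trans (cong (_⊖ v) eq) (⊖-⊕ v o'))
    where
    ⊖-⊕ : ∀ v o → (v ⊕ o) ⊖ v ≡ o
    ⊖-⊕ (c , d) (a , b) = cong₂ _,_ (identity c a) (identity d b)
      where identity : ∀ c a → (c + a) - c ≡ a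
            identity = solve-∀

  ⊕-cancelʳ : ∀ {u u'} o → u ⊕ o ≡ u' ⊕ o → u ≡ u'
  ⊕-cancelʳ {u} {u'} o eq = ⊕-cancelˡ o (trans (⊕-comm o u) (trans eq (⊕-comm u' o)))
    where
    ⊕-comm : ∀ u w → u ⊕ w ≡ w ⊕ u
    ⊕-comm (a , b) (c , d) = cong₂ _,_ (ℤₚ.+-comm a c) (ℤₚ.+-comm b d)

  unit : Fin 6 → Node
  unit 0F = (+ 1 , + 0)
  unit 1F = (+ 1 , + 1)
  unit 2F = (+ 0 , + 1)
  unit 3F = (-[1+ 0 ] , + 0)
  unit 4F = (-[1+ 0 ] , -[1+ 0 ])
  unit 5F = (+ 0 , -[1+ 0 ])

  next : Fin 6 → Fin 6
  next 0F = 1F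
  next 1F = 2F
  next 2F = 3F
  next 3F = 4F
  next 4F = 5F
  next 5F = 0F

  adj-cast : ∀ {u u' w w'} → u ≡ u' → w ≡ w' → Adj u w → Adj u' w'
  adj-cast refl refl e = e

  unit-adj : ∀ u d → Adj u (u ⊕ unit d)
  unit-adj (x , y) 0F = adj-cast refl (cong (x + 1ℤ ,_) (sym (ℤₚ.+-identityʳ y))) (right x y)
  unit-adj (x , y) 1F = diag+ x y
  unit-adj (x , y) 2F = adj-cast refl (cong (_, y + 1ℤ) (sym (ℤₚ.+-identityʳ x))) (up x y)
  unit-adj (x , y) 3F = adj-cast refl (cong (x - 1ℤ ,_) (sym (ℤₚ.+-identityʳ y))) (left x y)
  unit-adj (x , y) 4F = diag- x y
  unit-adj (x , y) 5F = adj-cast refl (cong (_, y - 1ℤ) (sym (ℤₚ.+-identityʳ x))) (down x y)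

  adj-unit : ∀ {u w} → Adj u w → Σ (Fin 6) λ d → w ≡ u ⊕ unit d
  adj-unit (right x y) = 0F , cong (x + 1ℤ ,_) (sym (ℤₚ.+-identityʳ y))
  adj-unit (diag+ x y) = 1F , refl
  adj-unit (up x y)    = 2F , cong (_, y + 1ℤ) (sym (ℤₚ.+-identityʳ x))
  adj-unit (left x y)  = 3F , cong (x - 1ℤ ,_) (sym (ℤₚ.+-identityʳ y))
  adj-unit (diag- x y) = 4F , refl
  adj-unit (down x y)  = 5F , cong (_, y - 1ℤ) (sym (ℤₚ.+-identityʳ x))

  translate-adj : ∀ v {u w} → Adj u w → Adj (v ⊕ u) (v ⊕ w)
  translate-adj v {u} e with adj-unit e
  ... | d , refl = adj-cast refl (⊕-assoc v u (unit d)) (unit-adj (v ⊕ u) d)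

  rotate : Node → Node
  rotate (x , y) = (x - y , x)

  rotate-⊕ : ∀ u o → rotate (u ⊕ o) ≡ rotate u ⊕ rotate o
  rotate-⊕ (x , y) (a , b) = cong₂ _,_ (identity x y a b) refl
    where identity : ∀ x y a b → (x + a) - (y + b) ≡ (x - y) + (a - b)
          identity = solve-∀

  rotate-unit : ∀ d → rotate (unit d) ≡ unit (next d)
  rotate-unit 0F = refl
  rotate-unit 1F = refl
  rotate-unit 2F = refl
  rotate-unit 3F = refl
  rotate-unit 4F = refl
  rotate-unit 5F = refl

  rotate-adj : ∀ {u w} → Adj u w → Adj (rotate u) (rotate w)
  rotate-adj {u} e with adj-unit e
  ... | d , refl = adj-cast refl (sym (trans (rotate-⊕ u (unit d)) (cong (rotate u ⊕_) (rotate-unit d))))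
                              (unit-adj (rotate u) (next d))

  turn : ℕ → Node → Node
  turn zero    u = u
  turn (suc n) u = rotate (turn n u)

  turn-adj : ∀ n {u w} → Adj u w → Adj (turn n u) (turn n w)
  turn-adj zero    e = e
  turn-adj (suc n) e = rotate-adj (turn-adj n e)

  turn-origin : ∀ n → turn n origin ≡ origin
  turn-origin zero    = refl
  turn-origin (suc n) = cong rotate (turn-origin n)

  embed : Node → Fin 6 → Node → Node
  embed v s o = v ⊕ turn (toℕ s) o

  embed-adj : ∀ v s {u w} → Adj u w → Adj (embed v s u) (embed v s w)
  embed-adj v s e = translate-adj v (turn-adj (toℕ s) e)

  embed-origin : ∀ v s → embed v s origin ≡ v
  embed-origin v s = trans (cong (v ⊕_) (turn-origin (toℕ s))) (⊕-origin v)

  map-walk : (f : Node → Node) → (∀ {u w} → Adj u w → Adj (f u) (f w)) →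
             ∀ {u w n} → Walk u w n → Walk (f u) (f w) n
  map-walk f f-adj here       = here
  map-walk f f-adj (step e p) = step (f-adj e) (map-walk f f-adj p)

module Sectors where
  open import Data.Integer using (ℤ; +_; -[1+_]; 1ℤ; ∣_∣; _+_; _-_; -_)
  import Data.Integer.Properties as ℤₚ
  open import Data.Integer.Tactic.RingSolver using (solve-∀)
  open Grid

  -- The base sector: A·(1,0) + B·(1,1).
  lattice : ℤ → ℤ → Node
  lattice A B = (A + B , B)

  lattice-edge : ∀ A B {w} d → lattice A B ⊕ unit d ≡ w → Adj (lattice A B) w
  lattice-edge A B d eq = adj-cast refl eq (unit-adj (lattice A B) d)

  trade-A-for-B : ∀ A B → Adj (lattice (1ℤ + A) B) (lattice A (1ℤ + B))
  trade-A-for-B A B = lattice-edge (1ℤ + A) B 2F (cong₂ _,_ (x-coordinate A B) (y-coordinate B))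
    where x-coordinate : ∀ A B → ((1ℤ + A) + B) + + 0 ≡ A + (1ℤ + B)
          x-coordinate = solve-∀
          y-coordinate : ∀ B → B + 1ℤ ≡ 1ℤ + B
          y-coordinate = solve-∀

  trade-B-for-A : ∀ A B → Adj (lattice A (1ℤ + B)) (lattice (1ℤ + A) B)
  trade-B-for-A A B = lattice-edge A (1ℤ + B) 5F (cong₂ _,_ (x-coordinate A B) (y-coordinate B))
    where x-coordinate : ∀ A B → (A + (1ℤ + B)) + + 0 ≡ (1ℤ + A) + B
          x-coordinate = solve-∀
          y-coordinate : ∀ B → (1ℤ + B) + - 1ℤ ≡ B
          y-coordinate = solve-∀

  drop-A : ∀ A B → Adj (lattice (1ℤ + A) B) (lattice A B)
  drop-A A B = lattice-edge (1ℤ + A) B 3F (cong₂ _,_ (x-coordinate A B) (ℤₚ.+-identityʳ B))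
    where x-coordinate : ∀ A B → ((1ℤ + A) + B) + - 1ℤ ≡ A + B
          x-coordinate = solve-∀

  drop-B : ∀ A B → Adj (lattice A (1ℤ + B)) (lattice A B)
  drop-B A B = lattice-edge A (1ℤ + B) 4F (cong₂ _,_ (x-coordinate A B) (y-coordinate B))
    where x-coordinate : ∀ A B → (A + (1ℤ + B)) + - 1ℤ ≡ A + B
          x-coordinate = solve-∀
          y-coordinate : ∀ B → (1ℤ + B) + - 1ℤ ≡ B
          y-coordinate = solve-∀

  lattice-walk : ∀ a b → Walk (lattice (+ a) (+ b)) origin (a ℕ.+ b)
  lattice-walk zero    zero    = here
  lattice-walk (suc a) zero    = step (drop-A (+ a) (+ 0)) (lattice-walk a zero)
  lattice-walk a       (suc b) =
    subst (Walk _ origin) (sym (ℕₚ.+-suc a b)) (step (drop-B (+ a) (+ b)) (lattice-walk a b))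

  -- Explicit coordinates of A·e_s + B·e_(s+1) with e_s = unit s.
  sectorCoords : Fin 6 → ℤ → ℤ → Node
  sectorCoords 0F A B = (A + B , B)
  sectorCoords 1F A B = (A , A + B)
  sectorCoords 2F A B = (- B , A)
  sectorCoords 3F A B = (- (A + B) , - B)
  sectorCoords 4F A B = (- A , - (A + B))
  sectorCoords 5F A B = (B , - A)

  rotate-to : ∀ {x y x'} → x - y ≡ x' → rotate (x , y) ≡ (x' , x)
  rotate-to {x = x} eq = cong (_, x) eq

  rotate-sector : ∀ s A B → rotate (sectorCoords s A B) ≡ sectorCoords (next s) A B
  rotate-sector 0F A B = rotate-to (difference A B)
    where difference : ∀ A B → (A + B) - B ≡ A
          difference = solve-∀
  rotate-sector 1F A B = rotate-to (difference A B)
    where difference : ∀ A B → A - (A + B) ≡ - B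
          difference = solve-∀
  rotate-sector 2F A B = rotate-to (difference A B)
    where difference : ∀ A B → - B - A ≡ - (A + B)
          difference = solve-∀
  rotate-sector 3F A B = rotate-to (difference A B)
    where difference : ∀ A B → - (A + B) - - B ≡ - A
          difference = solve-∀
  rotate-sector 4F A B = rotate-to (difference A B)
    where difference : ∀ A B → - A - - (A + B) ≡ B
          difference = solve-∀
  rotate-sector 5F A B = rotate-to (difference A B)
    where difference : ∀ A B → B - - A ≡ A + B
          difference = solve-∀

  turn-lattice : ∀ s A B → turn (toℕ s) (lattice A B) ≡ sectorCoords s A B
  turn-lattice s A B = trans (along (toℕ s)) (cong (λ s′ → sectorCoords s′ A B) (cycle-toℕ s))
    where
    cycle : ℕ → Fin 6
    cycle zero    = 0F
    cycle (suc n) = next (cycle n)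
    along : ∀ n → turn n (lattice A B) ≡ sectorCoords (cycle n) A B
    along zero    = refl
    along (suc n) = trans (cong rotate (along n)) (rotate-sector (cycle n) A B)
    cycle-toℕ : ∀ s → cycle (toℕ s) ≡ s
    cycle-toℕ 0F = refl
    cycle-toℕ 1F = refl
    cycle-toℕ 2F = refl
    cycle-toℕ 3F = refl
    cycle-toℕ 4F = refl
    cycle-toℕ 5F = refl

  -- A ray point: sector s, lattice coordinates (a+1 , b).
  Code : Set
  Code = Fin 6 × ℕ × ℕ

  ray : Code → Node
  ray (s , a , b) = sectorCoords s (+ suc a) (+ b)

  embed-ray : ∀ v s a b → embed v s (lattice (+ suc a) (+ b)) ≡ v ⊕ ray (s , a , b)
  embed-ray v s a b = cong (v ⊕_) (turn-lattice s (+ suc a) (+ b))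

  -- Reading the code back off a node.  Inside the first and third quadrants two
  -- sectors meet and the sign of x - y tells them apart.
  firstQuadrant : ℕ → ℕ → ℤ → Maybe Code
  firstQuadrant m n (+ suc a) = just (0F , a , n)
  firstQuadrant m n (+ zero)  = just (1F , m , 0)
  firstQuadrant m n -[1+ b ]  = just (1F , m , suc b)

  thirdQuadrant : ℕ → ℕ → ℤ → Maybe Code
  thirdQuadrant m n -[1+ a ] = just (3F , a , suc n)
  thirdQuadrant m n (+ b)    = just (4F , m , b)

  decode : Node → Maybe Code
  decode (+ m , -[1+ n ])      = just (5F , n , m)
  decode (+ zero , + zero)     = nothing
  decode (+ zero , + suc n)    = just (2F , n , 0)
  decode (+ suc m , + n)       = firstQuadrant m n (+ suc m - + n)
  decode (-[1+ m ] , + zero)   = just (3F , m , 0)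
  decode (-[1+ m ] , + suc n)  = just (2F , n , suc m)
  decode (-[1+ m ] , -[1+ n ]) = thirdQuadrant m n (-[1+ m ] - -[1+ n ])

  decode-ray : ∀ c → decode (ray c) ≡ just c
  decode-ray (0F , a , b) = cong (firstQuadrant (a ℕ.+ b) b) (difference (+ suc a) (+ b))
    where difference : ∀ A B → (A + B) - B ≡ A
          difference = solve-∀
  decode-ray (1F , a , b) =
    trans (cong (firstQuadrant a (suc a ℕ.+ b)) (difference (+ suc a) (+ b))) (non-positive b)
    where difference : ∀ A B → A - (A + B) ≡ - B
          difference = solve-∀
          non-positive : ∀ b → firstQuadrant a (suc a ℕ.+ b) (- (+ b)) ≡ just (1F , a , b)
          non-positive zero    = refl
          non-positive (suc b) = refl
  decode-ray (2F , a , zero)  = refl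
  decode-ray (2F , a , suc b) = refl
  decode-ray (3F , a , zero)  = cong (λ k → just (3F , k , 0)) (ℕₚ.+-identityʳ a)
  decode-ray (3F , a , suc b) = cong (thirdQuadrant (a ℕ.+ suc b) b) (difference (+ suc a) (+ suc b))
    where difference : ∀ A B → - (A + B) - - B ≡ - A
          difference = solve-∀
  decode-ray (4F , a , b) = cong (thirdQuadrant a (a ℕ.+ b)) (difference (+ suc a) (+ b))
    where difference : ∀ A B → - A - - (A + B) ≡ B
          difference = solve-∀
  decode-ray (5F , a , b) = refl

  ray-injective : ∀ {c c'} → ray c ≡ ray c' → c ≡ c'
  ray-injective {c} {c'} eq =
    just-injective (trans (sym (decode-ray c)) (trans (cong decode eq) (decode-ray c')))
    where just-injective : ∀ {x y : Code} → just x ≡ just y → x ≡ y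
          just-injective refl = refl

  ray-nonzero : ∀ c → ray c ≢ origin
  ray-nonzero c eq with trans (sym (decode-ray c)) (cong decode eq)
  ... | ()

  recover-x : ∀ x y {d} → x - y ≡ d → d + y ≡ x
  recover-x x y refl = identity x y
    where identity : ∀ x y → (x - y) + y ≡ x
          identity = solve-∀

  recover-y : ∀ x y {d} → x - y ≡ d → x - d ≡ y
  recover-y x y refl = identity x y
    where identity : ∀ x y → x - (x - y) ≡ y
          identity = solve-∀

  neg-+ : ∀ A B → - (A + B) ≡ - A + - B
  neg-+ = solve-∀

  classify : ∀ o → o ≡ origin ⊎ Σ Code λ c → ray c ≡ o
  classify (+ m , -[1+ n ])    = inj₂ ((5F , n , m) , refl)
  classify (+ zero , + zero)   = inj₁ refl
  classify (+ zero , + suc n)  = inj₂ ((2F , n , 0) , refl)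
  classify (+ suc m , + n) with + suc m - + n in eq
  ... | + suc a  = inj₂ ((0F , a , n) , cong (_, + n) (recover-x (+ suc m) (+ n) eq))
  ... | + zero   = inj₂ ((1F , m , 0) , cong (+ suc m ,_) (recover-y (+ suc m) (+ n) eq))
  ... | -[1+ b ] = inj₂ ((1F , m , suc b) , cong (+ suc m ,_) (recover-y (+ suc m) (+ n) eq))
  classify (-[1+ m ] , + zero)  =
    inj₂ ((3F , m , 0) , cong (λ k → (-[1+ k ] , + 0)) (ℕₚ.+-identityʳ m))
  classify (-[1+ m ] , + suc n) = inj₂ ((2F , n , suc m) , refl)
  classify (-[1+ m ] , -[1+ n ]) with -[1+ m ] - -[1+ n ] in eq
  ... | -[1+ a ] = inj₂ ((3F , a , suc n) ,
                         cong (_, -[1+ n ]) (trans (neg-+ (+ suc a) (+ suc n)) (recover-x -[1+ m ] -[1+ n ] eq)))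
  ... | + b      = inj₂ ((4F , m , b) ,
                         cong (-[1+ m ] ,_) (trans (neg-+ (+ suc m) (+ b)) (recover-y -[1+ m ] -[1+ n ] eq)))

  data Axis : Set where
    x-axis y-axis diagonal : Axis

  height : Axis → Node → ℤ
  height x-axis   (x , y) = x
  height y-axis   (x , y) = y
  height diagonal (x , y) = x - y

  height-⊕ : ∀ ax u o → height ax (u ⊕ o) ≡ height ax u + height ax o
  height-⊕ x-axis   u       o       = refl
  height-⊕ y-axis   u       o       = refl
  height-⊕ diagonal (x , y) (a , b) = identity x y a b
    where identity : ∀ x y a b → (x + a) - (y + b) ≡ (x - y) + (a - b)
          identity = solve-∀

  unit-height : ∀ d ax → ∣ height ax (unit d) ∣ ≤ 1
  unit-height 0F = λ { x-axis → s≤s z≤n ; y-axis → z≤n     ; diagonal → s≤s z≤n }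
  unit-height 1F = λ { x-axis → s≤s z≤n ; y-axis → s≤s z≤n ; diagonal → z≤n }
  unit-height 2F = λ { x-axis → z≤n     ; y-axis → s≤s z≤n ; diagonal → s≤s z≤n }
  unit-height 3F = λ { x-axis → s≤s z≤n ; y-axis → z≤n     ; diagonal → s≤s z≤n }
  unit-height 4F = λ { x-axis → s≤s z≤n ; y-axis → s≤s z≤n ; diagonal → z≤n }
  unit-height 5F = λ { x-axis → z≤n     ; y-axis → s≤s z≤n ; diagonal → s≤s z≤n }

  walk-height : ∀ ax {u w n} → Walk u w n → ∣ height ax u - height ax w ∣ ≤ n
  walk-height ax {u} here = ℕₚ.≤-reflexive (cong ∣_∣ (ℤₚ.+-inverseʳ (height ax u)))
  walk-height ax {u} {w} (step {w = u'} {n = n} e p) with adj-unit e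
  ... | d , refl = begin
    ∣ h u - h w ∣                               ≡⟨ cong ∣_∣ (split (h u) (h u') (h w)) ⟩
    ∣ (h u - h u') + (h u' - h w) ∣             ≤⟨ ℤₚ.∣i+j∣≤∣i∣+∣j∣ (h u - h u') (h u' - h w) ⟩
    ∣ h u - h u' ∣ ℕ.+ ∣ h u' - h w ∣          ≡⟨ cong (ℕ._+ ∣ h u' - h w ∣) first-edge ⟩
    ∣ height ax (unit d) ∣ ℕ.+ ∣ h u' - h w ∣  ≤⟨ ℕₚ.+-mono-≤ (unit-height d ax) (walk-height ax p) ⟩
    suc n                                       ∎
    where
    open ℕₚ.≤-Reasoning
    h : Node → ℤ
    h = height ax
    split : ∀ a b c → a - c ≡ (a - b) + (b - c)
    split = solve-∀
    back : ∀ a δ → a - (a + δ) ≡ - δ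
    back = solve-∀
    first-edge : ∣ h u - h u' ∣ ≡ ∣ height ax (unit d) ∣
    first-edge = begin-equality
      ∣ h u - h (u ⊕ unit d) ∣                ≡⟨ cong (λ z → ∣ h u - z ∣) (height-⊕ ax u (unit d)) ⟩
      ∣ h u - (h u + height ax (unit d)) ∣    ≡⟨ cong ∣_∣ (back (h u) (height ax (unit d))) ⟩
      ∣ - height ax (unit d) ∣                ≡⟨ ℤₚ.∣-i∣≡∣i∣ (height ax (unit d)) ⟩
      ∣ height ax (unit d) ∣                  ∎

  offset-height : ∀ ax v o {n} → Walk (v ⊕ o) v n → ∣ height ax o ∣ ≤ n
  offset-height ax v o p = subst (_≤ _) (cong ∣_∣ shift) (walk-height ax p)
    where
    cancel : ∀ a b → (a + b) - a ≡ b
    cancel = solve-∀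
    shift : height ax (v ⊕ o) - height ax v ≡ height ax o
    shift = trans (cong (_- height ax v) (height-⊕ ax v o)) (cancel (height ax v) (height ax o))

  -- On sector s one of the heights measures the hexagonal norm a+1+b.
  normAxis : Fin 6 → Axis
  normAxis 0F = x-axis
  normAxis 1F = y-axis
  normAxis 2F = diagonal
  normAxis 3F = x-axis
  normAxis 4F = y-axis
  normAxis 5F = diagonal

  ray-height : ∀ s a b → ∣ height (normAxis s) (ray (s , a , b)) ∣ ≡ suc (a ℕ.+ b)
  ray-height 0F a b = refl
  ray-height 1F a b = refl
  ray-height 2F a b = cong ∣_∣ (identity (+ suc a) (+ b))
    where identity : ∀ A B → - B - A ≡ - (A + B)
          identity = solve-∀
  ray-height 3F a b = refl
  ray-height 4F a b = refl
  ray-height 5F a b = cong ∣_∣ (identity (+ suc a) (+ b))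
    where identity : ∀ A B → B - - A ≡ A + B
          identity = solve-∀

  locate : ∀ {u v n} → u ≢ v → Walk u v n →
           Σ Code λ { (s , a , b) → v ⊕ ray (s , a , b) ≡ u × suc (a ℕ.+ b) ≤ n }
  locate {u} {v} u≢v p with classify (u ⊖ v)
  ... | inj₁ u⊖v≡0 = ⊥-elim (u≢v (trans (sym (⊕-⊖ v u)) (trans (cong (v ⊕_) u⊖v≡0) (⊕-origin v))))
  ... | inj₂ ((s , a , b) , ray≡) = (s , a , b) , at-u , bound
    where
    at-u : v ⊕ ray (s , a , b) ≡ u
    at-u = trans (cong (v ⊕_) ray≡) (⊕-⊖ v u)
    bound : suc (a ℕ.+ b) ≤ _
    bound = subst (_≤ _) (ray-height s a b)
              (offset-height (normAxis s) v (ray (s , a , b)) (subst (λ z → Walk z v _) (sym at-u) p))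

-- The boustrophedon order on the cells of a sector.  Rank k+1 is the cell
-- (a+1 , b) with (a , b) = snake k; diagonal d holds ranks T d + 1 … T (d+1).
module DiagonalOrder where
  open import Data.Nat
  open import Data.Nat.Properties
  open import Data.Nat.Combinatorics using (nC1≡n; nCk+nC[k+1]≡[n+1]C[k+1])
  open import Data.Parity.Base using (Parity; 0ℙ; 1ℙ; _⁻¹)
  open import Data.Parity.Properties using (suc-homo-⁻¹; ⁻¹-selfInverse)
  open import Relation.Nullary using (yes; no)
  open import Relation.Nullary.Negation using (contradiction)

  T : ℕ → ℕ
  T zero    = 0
  T (suc n) = suc n + T n

  triangular-binomial : ∀ r → suc r C 2 ≡ T r
  triangular-binomial zero    = refl
  triangular-binomial (suc r) = begin
    suc (suc r) C 2           ≡⟨ sym (nCk+nC[k+1]≡[n+1]C[k+1] (suc r) 1) ⟩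
    suc r C 1 + suc r C 2     ≡⟨ cong₂ _+_ (nC1≡n (suc r)) (triangular-binomial r) ⟩
    suc r + T r               ∎
    where open ≡-Reasoning

  T-mono : ∀ {m n} → m ≤ n → T m ≤ T n
  T-mono z≤n       = z≤n
  T-mono (s≤s m≤n) = s≤s (+-mono-≤ m≤n (T-mono m≤n))

  T-reflects-< : ∀ {m n} → T m < T n → m < n
  T-reflects-< {m} {n} lt with m <? n
  ... | yes m<n = m<n
  ... | no  m≮n = contradiction lt (≤⇒≯ (T-mono (≮⇒≥ m≮n)))

  size : ℕ × ℕ → ℕ
  size (p , q) = p + q

  pair : ℕ × ℕ → ℕ
  pair (p , q) = T (p + q) + p

  pair-bound : ∀ p q → suc (pair (p , q)) ≤ T (suc (p + q))
  pair-bound p q =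
    s≤s (subst (T (p + q) + p ≤_) (+-comm (T (p + q)) (p + q)) (+-monoʳ-≤ (T (p + q)) (m≤m+n p q)))

  advance : ℕ × ℕ → ℕ × ℕ
  advance (p , suc q) = (suc p , q)
  advance (p , zero)  = (zero , suc p)

  unpair : ℕ → ℕ × ℕ
  unpair zero    = (0 , 0)
  unpair (suc k) = advance (unpair k)

  pair-advance : ∀ c → pair (advance c) ≡ suc (pair c)
  pair-advance (p , suc q) = begin
    T (suc p + q) + suc p     ≡⟨ +-suc (T (suc (p + q))) p ⟩
    suc (T (suc (p + q)) + p) ≡⟨ cong (λ d → suc (T d + p)) (sym (+-suc p q)) ⟩
    suc (T (p + suc q) + p)   ∎
    where open ≡-Reasoning
  pair-advance (p , zero) = begin
    T (suc p) + 0             ≡⟨ +-identityʳ (T (suc p)) ⟩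
    suc (p + T p)             ≡⟨ cong suc (+-comm p (T p)) ⟩
    suc (T p + p)             ≡⟨ cong (λ d → suc (T d + p)) (sym (+-identityʳ p)) ⟩
    suc (T (p + 0) + p)       ∎
    where open ≡-Reasoning

  pair-unpair : ∀ k → pair (unpair k) ≡ k
  pair-unpair zero    = refl
  pair-unpair (suc k) = trans (pair-advance (unpair k)) (cong suc (pair-unpair k))

  unpair-pair : ∀ c → unpair (pair c) ≡ c
  unpair-pair (p , q) = along-diagonal (p + q) p q refl
    where
    along-diagonal : ∀ d p q → p + q ≡ d → unpair (pair (p , q)) ≡ (p , q)
    along-diagonal d       zero    zero    _  = refl
    along-diagonal d       (suc p) q       eq =
      trans (cong unpair (pair-advance (p , suc q)))
            (cong advance (along-diagonal d p (suc q) (trans (+-suc p q) eq)))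
    along-diagonal (suc d) zero    (suc q) eq =
      trans (cong unpair (pair-advance (q , 0)))
            (cong advance (along-diagonal d q 0 (trans (+-identityʳ q) (suc-injective eq))))

  orientBy : Parity → ℕ → ℕ → ℕ × ℕ
  orientBy 0ℙ p q = (p , q)
  orientBy 1ℙ p q = (q , p)

  orient : ℕ × ℕ → ℕ × ℕ
  orient (p , q) = orientBy (parity (p + q)) p q

  parity-suc : ∀ n → parity (suc n) ≡ parity n ⁻¹
  parity-suc n = sym (⁻¹-selfInverse (suc-homo-⁻¹ n))

  orient-size : ∀ c → size (orient c) ≡ size c
  orient-size (p , q) with parity (p + q)
  ... | 0ℙ = refl
  ... | 1ℙ = +-comm q p

  orient-injective : ∀ {c c'} → orient c ≡ orient c' → c ≡ c'
  orient-injective {p , q} {p' , q'} eq with parity (p + q) in e | parity (p' + q') in e' | eq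
  ... | 0ℙ | 0ℙ | refl = refl
  ... | 1ℙ | 1ℙ | refl = refl
  ... | 0ℙ | 1ℙ | refl with () ← trans (sym e) (trans (cong parity (+-comm p q)) e')
  ... | 1ℙ | 0ℙ | refl with () ← trans (sym e) (trans (cong parity (+-comm p q)) e')

  snake : ℕ → ℕ × ℕ
  snake k = orient (unpair k)

  snake-injective : ∀ {k k'} → snake k ≡ snake k' → k ≡ k'
  snake-injective {k} {k'} eq =
    trans (sym (pair-unpair k)) (trans (cong pair (orient-injective eq)) (pair-unpair k'))

  snake-reach : ∀ a b → Σ ℕ λ k → snake k ≡ (a , b) × suc k ≤ T (suc (a + b))
  snake-reach a b with parity (a + b) in e
  ... | 0ℙ = pair (a , b) ,
             trans (cong orient (unpair-pair (a , b))) (cong (λ π → orientBy π a b) e) ,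
             pair-bound a b
  ... | 1ℙ = pair (b , a) ,
             trans (cong orient (unpair-pair (b , a)))
                   (cong (λ π → orientBy π b a) (trans (cong parity (+-comm b a)) e)) ,
             subst (λ d → suc (pair (b , a)) ≤ T (suc d)) (+-comm b a) (pair-bound b a)

  snake-radius : ∀ {r} k → suc k ≤ T r → suc (size (snake k)) ≤ r
  snake-radius {r} k k<T = subst (λ d → suc d ≤ r) (sym (orient-size (unpair k)))
    (T-reflects-< (≤-<-trans (subst (T (size (unpair k)) ≤_) (pair-unpair k) (m≤m+n _ _)) k<T))

module Conveyor where
  open import Data.Nat
  open import Data.Nat.Properties
  open import Data.Parity.Base using (0ℙ; 1ℙ)
  open import Data.Integer using (+_)
  open Grid
  open Sectors
  open DiagonalOrder

  cell : ℕ → ℕ × ℕ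
  cell zero    = (0 , 0)
  cell (suc k) = (suc (proj₁ (snake k)) , proj₂ (snake k))

  latticeCell : ℕ × ℕ → Node
  latticeCell (A , B) = lattice (+ A) (+ B)

  -- Consecutive cells are adjacent: along a diagonal one unit of A is traded for
  -- one of B (or back), and between diagonals one coordinate drops.
  cell-step : ∀ k → Adj (latticeCell (cell (suc k))) (latticeCell (cell k))
  cell-step zero    = drop-A (+ 0) (+ 0)
  cell-step (suc k) = advance-edge (unpair k)
    where
    shifted : ℕ × ℕ → Node
    shifted (a , b) = lattice (+ suc a) (+ b)
    advance-edge : ∀ c → Adj (shifted (orient (advance c))) (shifted (orient c))
    advance-edge (p , suc q) rewrite +-suc p q with parity (suc (p + q))
    ... | 0ℙ = trade-A-for-B (+ suc p) (+ q)
    ... | 1ℙ = trade-B-for-A (+ suc q) (+ p)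
    advance-edge (p , zero) rewrite +-identityʳ p | parity-suc p with parity p
    ... | 0ℙ = drop-A (+ suc p) (+ 0)
    ... | 1ℙ = drop-B (+ 1) (+ p)

  station : Node → Fin 6 → ℕ → Node
  station v s k = embed v s (latticeCell (cell k))

  station-centre : ∀ v s → station v s 0 ≡ v
  station-centre = embed-origin

  station-step : ∀ v s k → Adj (station v s (suc k)) (station v s k)
  station-step v s k = embed-adj v s (cell-step k)

  station-ray : ∀ v s k → station v s (suc k) ≡ v ⊕ ray (s , snake k)
  station-ray v s k = embed-ray v s _ _

  station-off-centre : ∀ v s k → station v s (suc k) ≢ v
  station-off-centre v s k eq = ray-nonzero (s , snake k)
    (⊕-cancelˡ v (trans (sym (station-ray v s k)) (trans eq (sym (⊕-origin v)))))

  station-injective : ∀ v {s s' k k'} → station v s (suc k) ≡ station v s' (suc k') → s ≡ s' × k ≡ k'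
  station-injective v {s} {s'} {k} {k'} eq = cong proj₁ same-code , snake-injective (cong proj₂ same-code)
    where
    same-code : (s , snake k) ≡ (s' , snake k')
    same-code = ray-injective (⊕-cancelˡ v (trans (sym (station-ray v s k)) (trans eq (station-ray v s' k'))))

  station-cover : ∀ {v r u} → IsSource v r u →
                  Σ (Fin 6 × ℕ) λ { (s , k) → station v s (suc k) ≡ u × suc k ≤ T r }
  station-cover {v} (u≢v , n , n≤r , p) with locate u≢v p
  ... | (s , a , b) , at-u , a+b<n with snake-reach a b
  ... | k , snake≡ , k<T =
    (s , k) , trans (station-ray v s k) (trans (cong (λ c → v ⊕ ray (s , c)) snake≡) at-u) ,
    ≤-trans k<T (T-mono (≤-trans a+b<n n≤r))

  station-near : ∀ v s {r} k → suc k ≤ T r → DistLE (station v s (suc k)) v r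
  station-near v s k k<T = _ , snake-radius k k<T ,
    subst (λ w → Walk (station v s (suc k)) w _) (embed-origin v s)
          (map-walk (embed v s) (embed-adj v s) (lattice-walk (suc (proj₁ (snake k))) (proj₂ (snake k))))

module Counting where
  open import Data.Nat
  open import Data.Nat.Properties
  open import Data.Fin using (combine; remQuot)
  open import Data.Fin.Properties using (injective⇒≤; remQuot-combine; combine-remQuot)
  open import Relation.Nullary using (¬_; Dec; yes; no)
  open import Function using (_∘_)

  first-crossing : ∀ {P : ℕ → Set} → (∀ t → Dec (P t)) → ∀ {n} → ¬ P 0 → P n →
                   Σ ℕ λ t → t < n × ¬ P t × P (suc t)
  first-crossing P? {zero}  ¬P₀ Pₙ = ⊥-elim (¬P₀ Pₙ)
  first-crossing P? {suc n} ¬P₀ Pₙ₊₁ with P? n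
  ... | no  ¬Pₙ = n , ≤-refl , ¬Pₙ , Pₙ₊₁
  ... | yes Pₙ  with first-crossing P? ¬P₀ Pₙ
  ...   | t , t<n , ¬Pₜ , Pₜ₊₁ = t , m≤n⇒m≤1+n t<n , ¬Pₜ , Pₜ₊₁

  product-injection : ∀ {a b c d} (f : Fin a × Fin b → Fin c × Fin d) →
                      (∀ {i j} → f i ≡ f j → i ≡ j) → a * b ≤ c * d
  product-injection {a} {b} {c} {d} f f-injective = injective⇒≤ {f = merge ∘ f ∘ split} injective
    where
    split : Fin (a * b) → Fin a × Fin b
    split = remQuot b
    merge : Fin c × Fin d → Fin (c * d)
    merge (x , y) = combine x y
    split-injective : ∀ {i j} → split i ≡ split j → i ≡ j
    split-injective {i} {j} eq =
      trans (sym (combine-remQuot {a} b i)) (trans (cong (λ { (x , y) → combine x y }) eq) (combine-remQuot {a} b j))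
    merge-injective : ∀ {x y} → merge x ≡ merge y → x ≡ y
    merge-injective eq = trans (sym (remQuot-combine _ _)) (trans (cong (remQuot d) eq) (remQuot-combine _ _))
    injective : ∀ {i j} → merge (f (split i)) ≡ merge (f (split j)) → i ≡ j
    injective = split-injective ∘ f-injective ∘ merge-injective

module Routing (v : Node) (r : ℕ) where
  open import Data.Nat
  open import Data.Nat.Properties
  open DiagonalOrder
  open Conveyor

  countdown : ∀ K t → (K ∸ t ≡ 0 × K ∸ suc t ≡ 0) ⊎ Σ ℕ λ j → K ∸ t ≡ suc j × K ∸ suc t ≡ j
  countdown K t with K ∸ t in eq
  ... | zero  = inj₁ (refl , trans (sym (pred[m∸n]≡m∸[1+n] K t)) (cong pred eq))
  ... | suc j = inj₂ (j , refl , trans (sym (pred[m∸n]≡m∸[1+n] K t)) (cong pred eq))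

  countdown-injective : ∀ {K K' t j} → K ∸ t ≡ suc j → K' ∸ t ≡ suc j → K ≡ K'
  countdown-injective {K} {K'} {t} {j} eq eq' = ∸-cancelʳ-≡ (started eq) (started eq') (trans eq (sym eq'))
    where
    started : ∀ {M} → M ∸ t ≡ suc j → t ≤ M
    started {M} e = <⇒≤ (m∸n≢0⇒n<m {M} {t} (λ e₀ → 0≢1+n (trans (sym e₀) e)))

  address : (p : Packet v r) → Σ (Fin 6 × ℕ) λ { (s , k) → station v s (suc k) ≡ proj₁ p × suc k ≤ T r }
  address (u , source) = station-cover source

  sector : Packet v r → Fin 6
  sector p = proj₁ (proj₁ (address p))

  rank : Packet v r → ℕ
  rank p = suc (proj₂ (proj₁ (address p)))

  position : Packet v r → ℕ → Node
  position p t = station v (sector p) (rank p ∸ t)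

  position-step : ∀ p t → Move (position p t) (position p (suc t))
  position-step p t with countdown (rank p) t
  ... | inj₁ (stopped , still) = inj₁ (cong (station v (sector p)) (trans stopped (sym still)))
  ... | inj₂ (j , now , after) =
    inj₂ (subst₂ (λ a b → Adj (station v (sector p) a) (station v (sector p) b)) (sym now) (sym after)
                 (station-step v (sector p) j))

  position-absorbed : ∀ p t → position p t ≡ v → position p (suc t) ≡ v
  position-absorbed p t at-v with countdown (rank p) t
  ... | inj₁ (_ , still)   = trans (cong (station v (sector p)) still) (station-centre v (sector p))
  ... | inj₂ (j , now , _) =
    ⊥-elim (station-off-centre v (sector p) j (trans (cong (station v (sector p)) (sym now)) at-v))

  collision-at-centre : ∀ p q t → proj₁ p ≢ proj₁ q → position p t ≡ position q t → position p t ≡ v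
  collision-at-centre p q t p≢q same with countdown (rank p) t | countdown (rank q) t
  ... | inj₁ (stopped , _) | _ = trans (cong (station v (sector p)) stopped) (station-centre v (sector p))
  ... | inj₂ (j , now , _) | inj₁ (stopped' , _) =
    ⊥-elim (station-off-centre v (sector p) j
      (trans (cong (station v (sector p)) (sym now))
             (trans same (trans (cong (station v (sector q)) stopped') (station-centre v (sector q))))))
  ... | inj₂ (j , now , _) | inj₂ (j' , now' , _)
      with station-injective v {sector p} {sector q} {j} {j'}
             (trans (cong (station v (sector p)) (sym now)) (trans same (cong (station v (sector q)) now')))
  ...   | same-sector , refl = ⊥-elim (p≢q (begin
          proj₁ p                          ≡⟨ sym (proj₁ (proj₂ (address p))) ⟩
          station v (sector p) (rank p)    ≡⟨ cong₂ (station v) same-sector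
                                                    (countdown-injective {rank p} {rank q} {t} now now') ⟩
          station v (sector q) (rank q)    ≡⟨ proj₁ (proj₂ (address q)) ⟩
          proj₁ q                          ∎))
    where open ≡-Reasoning

  conveyorSchedule : Schedule v r
  conveyorSchedule = record
    { pos      = position
    ; start    = λ p → proj₁ (proj₂ (address p))
    ; moves    = position-step
    ; absorbed = position-absorbed
    ; capacity = λ p q t p≢q same _ →
        let at-v = collision-at-centre p q t p≢q same in trans at-v (sym (position-absorbed p t at-v))
    }

  conveyorSchedule-delivers : DeliversBy conveyorSchedule (T r)
  conveyorSchedule-delivers p =
    trans (cong (station v (sector p)) (m≤n⇒m∸n≡0 (proj₂ (proj₂ (address p))))) (station-centre v (sector p))

module LowerBound (v : Node) (r : ℕ) where
  open import Data.Nat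
  open import Data.Nat.Properties
  open import Data.Fin using (fromℕ<)
  open import Data.Fin.Properties using (toℕ<n; toℕ-injective; toℕ-fromℕ<)
  open import Data.Integer.Properties using () renaming (_≟_ to _≟ℤ_)
  open import Data.Product.Properties using (≡-dec)
  open import Relation.Nullary using (Dec)
  open import Relation.Nullary.Decidable using (decidable-stable)
  open Grid
  open DiagonalOrder
  open Conveyor
  open Counting

  _≟ᴺ_ : (u w : Node) → Dec (u ≡ w)
  _≟ᴺ_ = ≡-dec _≟ℤ_ _≟ℤ_

  conveyorPacket : Fin (T r) × Fin 6 → Packet v r
  conveyorPacket (k , s) =
    station v s (suc (toℕ k)) , station-off-centre v s (toℕ k) , station-near v s (toℕ k) (toℕ<n k)

  conveyorPacket-injective : ∀ {i j} → proj₁ (conveyorPacket i) ≡ proj₁ (conveyorPacket j) → i ≡ j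
  conveyorPacket-injective {k , s} {k' , s'} eq with station-injective v {s} {s'} eq
  ... | refl , same-rank = cong (_, s) (toℕ-injective same-rank)

  module _ {T' : ℕ} (S : Schedule v r) (delivered : DeliversBy S T') where
    open Schedule S

    arrival : (p : Packet v r) → Σ ℕ λ t → t < T' × pos p t ≢ v × pos p (suc t) ≡ v
    arrival p = first-crossing (λ t → pos p t ≟ᴺ v)
                  (λ at-v → proj₁ (proj₂ p) (trans (sym (start p)) at-v)) (delivered p)

    last-edge : ∀ p t → pos p t ≢ v → pos p (suc t) ≡ v → Σ (Fin 6) λ d → pos p t ⊕ unit d ≡ v
    last-edge p t not-yet arrived with moves p t
    ... | inj₁ stay = ⊥-elim (not-yet (trans stay arrived))
    ... | inj₂ e with adj-unit e
    ...   | d , next≡ = d , trans (sym next≡) arrived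

    shared-entry : ∀ p q t d → pos p t ≢ v → pos p t ⊕ unit d ≡ v → pos q t ⊕ unit d ≡ v →
                   pos p (suc t) ≡ v → pos q (suc t) ≡ v → proj₁ p ≡ proj₁ q
    shared-entry p q t d not-yet p-enters q-enters p-arrived q-arrived =
      decidable-stable (proj₁ p ≟ᴺ proj₁ q) λ p≢q →
        not-yet (trans (capacity p q t p≢q same-node (trans p-arrived (sym q-arrived))) p-arrived)
      where
      same-node : pos p t ≡ pos q t
      same-node = ⊕-cancelʳ (unit d) (trans p-enters (sym q-enters))

    record Entry (p : Packet v r) : Set where
      field
        time      : ℕ
        in-time   : time < T'
        before    : pos p time ≢ v
        after     : pos p (suc time) ≡ v
        direction : Fin 6
        via       : pos p time ⊕ unit direction ≡ v

    entry : ∀ p → Entry p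
    entry p with arrival p
    ... | t , t<T' , not-yet , arrived with last-edge p t not-yet arrived
    ...   | d , via-d = record { time = t ; in-time = t<T' ; before = not-yet ; after = arrived
                               ; direction = d ; via = via-d }

    slot : Fin (T r) × Fin 6 → Fin T' × Fin 6
    slot i = fromℕ< (Entry.in-time (entry (conveyorPacket i))) , Entry.direction (entry (conveyorPacket i))

    slot-injective : ∀ {i j} → slot i ≡ slot j → i ≡ j
    slot-injective {i} {j} same-slot = conveyorPacket-injective
      (shared-entry p q (time entry-p) (direction entry-p) (before entry-p) (via entry-p) q-via
                    (after entry-p) q-after)
      where
      open Entry
      p q : Packet v r
      p = conveyorPacket i
      q = conveyorPacket j
      entry-p : Entry p
      entry-p = entry p
      entry-q : Entry q
      entry-q = entry q
      same-time : time entry-q ≡ time entry-p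
      same-time = trans (sym (toℕ-fromℕ< (in-time entry-q)))
                    (trans (cong (λ x → toℕ (proj₁ x)) (sym same-slot)) (toℕ-fromℕ< (in-time entry-p)))
      q-via : pos q (time entry-p) ⊕ unit (direction entry-p) ≡ v
      q-via = subst₂ (λ t d → pos q t ⊕ unit d ≡ v) same-time (cong proj₂ (sym same-slot)) (via entry-q)
      q-after : pos q (suc (time entry-p)) ≡ v
      q-after = subst (λ t → pos q (suc t) ≡ v) same-time (after entry-q)

  lower-bound : ∀ {T'} (S : Schedule v r) → DeliversBy S T' → T r ≤ T'
  lower-bound {T'} S delivered =
    *-cancelʳ-≤ (T r) T' 6 (product-injection (slot S delivered) (slot-injective S delivered))

mainTheorem6 : ∀ (r : ℕ) → 1 ≤ r → ∀ (v : Node) →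
    (Σ (Schedule v r) λ S → DeliversBy S (suc r C 2))
    × (∀ (T : ℕ) (S : Schedule v r) → DeliversBy S T → suc r C 2 ≤ T)
mainTheorem6 r _ v =
  (conveyorSchedule , subst (DeliversBy conveyorSchedule) (sym (triangular-binomial r)) conveyorSchedule-delivers) ,
  λ T' S delivered → subst (_≤ T') (sym (triangular-binomial r)) (lower-bound S delivered)
  where
  open Routing v r using (conveyorSchedule; conveyorSchedule-delivers)
  open LowerBound v r using (lower-bound)
  open DiagonalOrder using (triangular-binomial)
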